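{- Let $\sigma$ and $\tau$ be permutations such that $\sigma$ occurs precisely once as a consecutive pattern in $\tau$, and suppose $\tau$ has a left tail of length $a$ and a right tail of length $b$ with respect to $\sigma$. Then $\mu(\sigma,\tau)=1$ if $a=b=0$ or $a=b=1$; $\mu(\sigma,\tau)=-1$ if $(a,b)=(0,1)$ or $(a,b)=(1,0)$; and $\mu(\sigma,\tau)=0$ otherwise.
   Context: Permutations are of $[d]=\{1,\dots,d\}$ for some $d\ge 1$. An occurrence of a consecutive pattern $\sigma=a_1\cdots a_k$ in $\tau=b_1\cdots b_n$ is a factor $b_ib_{i+1}\cdots b_{i+k-1}$ of consecutive letters of $\tau$ whose letters appear in the same relative order of size as the letters of $\sigma$. The set of all permutations is partially ordered by $\sigma\le\tau$ iff $\sigma$ occurs as a consecutive pattern in $\tau$; $\mu$ is the Möbius function of this poset: $\mu(x,x)=1$, $\mu(x,y)=-\sum_{x\le z<y}\mu(x,z)$ for $x<y$, and $\mu(x,y)=0$ if $x\not\le y$. If $\sigma$ occurs in $\tau=a_1\cdots a_n$, then $\tau$ has a left tail of length $i$ with respect to $\sigma$ if $a_{i+1}$ is the leftmost letter of $\tau$ involved in any occurrence of $\sigma$, and a right tail of length $j$ if $a_{n-j}$ is the rightmost letter of $\tau$ involved in any occurrence of $\sigma$. -}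

module Defs where

open import Data.Nat using (ℕ; zero; suc; _+_; _∸_; _≤_; _<_; _≤?_; _<?_)
open import Data.Integer using (ℤ; -_) renaming (_+_ to _+ℤ_; +_ to ⁺_)
open import Data.List using (List; []; _∷_; length; take; drop; map; filter; deduplicate; upTo; concatMap; foldr)
open import Data.List.Properties using (≡-dec)
open import Data.List.Relation.Unary.Any using (Any; any?)
open import Data.List.Relation.Binary.Permutation.Propositional using (_↭_)
open import Data.Product using (Σ; ∃; _×_; _,_)
open import Data.Bool using (if_then_else_)
open import Relation.Nullary using (Dec; does)
open import Relation.Nullary.Decidable using (_×-dec_)
open import Relation.Binary.PropositionalEquality using (_≡_)
import Data.Nat.Properties as ℕP

IsPerm : List ℕ → Set
IsPerm xs = (1 ≤ length xs) × (xs ↭ map suc (upTo (length xs)))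

-- For a word with distinct letters, std w is the unique permutation
-- whose letters are in the same relative order as those of w.
std : List ℕ → List ℕ
std w = map (λ x → suc (length (filter (λ y → y <? x) w))) w

factor : ℕ → ℕ → List ℕ → List ℕ
factor i k τ = take k (drop i τ)

-- σ occurs (as a consecutive pattern) in τ at 0-indexed position i,
-- i.e. the factor b_{i+1} … b_{i+|σ|} is order-isomorphic to σ.
OccAt : List ℕ → List ℕ → ℕ → Set
OccAt σ τ i = (i + length σ ≤ length τ) × (std (factor i (length σ) τ) ≡ σ)

occAt? : ∀ σ τ i → Dec (OccAt σ τ i)
occAt? σ τ i = (i + length σ ≤? length τ) ×-dec ≡-dec ℕP._≟_ (std (factor i (length σ) τ)) σ

Contains : List ℕ → List ℕ → Set
Contains σ τ = ∃ λ i → OccAt σ τ i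

contains? : ∀ σ τ → Dec (Any (OccAt σ τ) (upTo (suc (length τ))))
contains? σ τ = any? (occAt? σ τ) (upTo (suc (length τ)))

OccursOnce : List ℕ → List ℕ → Set
OccursOnce σ τ = ∃ λ i → OccAt σ τ i × (∀ j → OccAt σ τ j → j ≡ i)

-- τ = a_1 … a_n has a left tail of length a w.r.t. σ: a_{a+1} is the
-- leftmost letter involved in any occurrence of σ.
LeftTail : List ℕ → List ℕ → ℕ → Set
LeftTail σ τ a = OccAt σ τ a × (∀ j → OccAt σ τ j → a ≤ j)

-- τ has a right tail of length b w.r.t. σ: a_{n-b} is the rightmost letter
-- involved in any occurrence of σ.  (An occurrence at position j involves
-- a_{j+1} … a_{j+|σ|}.)
RightTail : List ℕ → List ℕ → ℕ → Set
RightTail σ τ b =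
  (∃ λ j → OccAt σ τ j × (j + length σ ≡ length τ ∸ b) × (b ≤ length τ))
  × (∀ j → OccAt σ τ j → j + length σ ≤ length τ ∸ b)

-- Standardised consecutive factors of τ of length 1 ≤ k < |τ|, without
-- repetitions.  For a permutation τ, these are exactly the permutations z
-- with z ≤ τ and z ≠ τ.
properPatterns : List ℕ → List (List ℕ)
properPatterns τ =
  deduplicate (≡-dec ℕP._≟_)
    (filter (λ z → length z <? length τ)
      (concatMap (λ i → map (λ k → std (factor i (suc k) τ))
                            (upTo (length τ ∸ i)))
                 (upTo (length τ))))

sumℤ : List ℤ → ℤ
sumℤ = foldr _+ℤ_ (⁺ 0)

-- Möbius function of the consecutive pattern poset, by the defining
-- recursion  μ(x,x)=1,  μ(x,y) = - Σ_{x ≤ z < y} μ(x,z),  μ(x,y)=0 if x ≰ y.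
-- The fuel n bounds |y|; every z < y is strictly shorter than y.
μ′ : ℕ → List ℕ → List ℕ → ℤ
μ′ n σ τ =
  if does (≡-dec ℕP._≟_ σ τ) then ⁺ 1 else
  (if does (contains? σ τ) then go n else ⁺ 0)
  where
  go : ℕ → ℤ
  go zero    = ⁺ 0
  go (suc m) = - sumℤ (map (μ′ m σ) (filter (contains? σ) (properPatterns τ)))

μ : List ℕ → List ℕ → ℤ
μ σ τ = μ′ (length τ) σ τ

module Submission where

-- Theorem 2.1: if σ occurs exactly once in τ, with a letters of τ to the
-- left of the occurrence and b to its right, then μ(σ,τ) = g(a)·g(b), where
-- g = 1, -1, 0, 0, … is the Möbius function of a chain.
--
-- Write ext i j (i ≤ a, j ≤ b) for the pattern of the factor of τ made of
-- the occurrence of σ extended by i letters to the left and j to the right.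
-- Every pattern z with σ ≤ z ≤ ext i j is itself such a factor, and the only
-- occurrence of σ in ext i j is the one inherited from τ, so
--   [σ, ext i j] ≅ [0,i] × [0,j]  via  (i',j') ↦ ext i' j'.
-- The Möbius function of a product of chains is the product of the chains'
-- Möbius functions, which gives μ(σ, ext i j) = g(i)·g(j) by induction along
-- the defining recursion of μ; τ itself is ext a b.

open import Defs
open import Data.Nat using (ℕ; zero; suc; _+_; _∸_; _≤_; _<_; _<ᵇ_; _⊓_; z≤n; s≤s; s<s⁻¹; s≤s⁻¹)
open import Data.Nat.Properties
open import Data.Nat.Solver using (module +-*-Solver)
open import Data.Bool using (true; false; if_then_else_)
open import Data.List using (List; []; _∷_; _++_; _∷ʳ_; length; take; drop; map; filter; upTo; applyUpTo; cartesianProduct)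
open import Data.List.Properties using (length-map; map-cong-local; take-map; drop-map; map-∘; map-id; map-++; map-upTo; drop-drop; take-drop; take-take; length-take; length-drop; take-all; ≡-dec; upTo-∷ʳ; filter-accept; filter-reject)
open import Data.List.Membership.Propositional using (_∈_; lose; find)
open import Data.List.Membership.Propositional.Properties using (∈-map⁺; ∈-map⁻; ∈-upTo⁺; ∈-upTo⁻; ∈-filter⁺; ∈-filter⁻; ∈-concatMap⁺; ∈-concatMap⁻; ∈-deduplicate⁺; ∈-deduplicate⁻; ∈-cartesianProduct⁺; ∈-cartesianProduct⁻)
open import Data.List.Relation.Unary.Any using (Any; here; there; satisfied)
open import Data.List.Relation.Unary.All as All using ()
open import Data.List.Relation.Unary.AllPairs using ([]; _∷_)
open import Data.List.Relation.Unary.Unique.Propositional using (Unique)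
import Data.List.Relation.Unary.Unique.Propositional.Properties as Unique
open import Data.List.Relation.Unary.Unique.DecPropositional.Properties using (deduplicate-!)
open import Data.List.Membership.Propositional.Properties.WithK using (unique∧set⇒bag)
open import Data.List.Relation.Binary.BagAndSetEquality using (∼bag⇒↭)
open import Function.Bundles using (mk⇔)
open import Data.List.Relation.Binary.Sublist.Propositional using (⊆-trans)
open import Data.List.Relation.Binary.Sublist.Propositional.Properties using (take-⊆; drop-⊆; Any-resp-⊆)
open import Data.List.Relation.Binary.Permutation.Propositional using (_↭_; ↭⇒↭ₛ)
open import Data.List.Relation.Binary.Permutation.Setoid.Properties using (foldr-commMonoid)
import Data.List.Relation.Binary.Permutation.Propositional.Properties as ↭
open import Data.Integer using (ℤ; +_; -[1+_]; -_) renaming (_+_ to _+ℤ_; _*_ to _*ℤ_)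
import Data.Integer.Properties as ℤ
open import Algebra.Bundles using (CommutativeMonoid; AbelianGroup)
open import Algebra.Properties.Group (AbelianGroup.group ℤ.+-0-abelianGroup) using (inverseʳ-unique)
open import Function using (_∘_)
open import Data.Product using (∃; _×_; _,_; proj₁; proj₂; uncurry)
open import Data.Sum using (_⊎_; inj₁; inj₂)
open import Data.Empty using (⊥; ⊥-elim)
open import Relation.Nullary using (¬_; yes; no; does)
open import Relation.Nullary.Decidable using (dec-true; dec-false; _×-dec_)
open import Relation.Binary.PropositionalEquality using (_≡_; _≢_; refl; sym; trans; cong; cong₂; subst; module ≡-Reasoning)
open +-*-Solver using (solve; _:+_; _:=_)

rank : List ℕ → ℕ → ℕ
rank w x = length (filter (_<? x) w)

rank-∷-< : ∀ w {y x} → y < x → rank (y ∷ w) x ≡ suc (rank w x)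
rank-∷-< w {x = x} y<x = cong length (filter-accept (_<? x) y<x)

rank-∷-≮ : ∀ w {y x} → ¬ y < x → rank (y ∷ w) x ≡ rank w x
rank-∷-≮ w {x = x} y≮x = cong length (filter-reject (_<? x) y≮x)

rank-mono : ∀ w {x y} → y ≤ x → rank w y ≤ rank w x
rank-mono [] _ = z≤n
rank-mono (z ∷ w) {x} {y} y≤x with z <? y | z <? x
... | yes z<y | yes z<x rewrite rank-∷-< w z<y | rank-∷-< w z<x = s≤s (rank-mono w y≤x)
... | yes z<y | no z≮x  = ⊥-elim (z≮x (<-≤-trans z<y y≤x))
... | no z≮y  | yes z<x rewrite rank-∷-≮ w z≮y | rank-∷-< w z<x = m≤n⇒m≤1+n (rank-mono w y≤x)
... | no z≮y  | no z≮x  rewrite rank-∷-≮ w z≮y | rank-∷-≮ w z≮x = rank-mono w y≤x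

rank-strict : ∀ w {x y} → y < x → y ∈ w → rank w y < rank w x
rank-strict (z ∷ w) {x} y<x (here refl) with z <? z | z <? x
... | yes z<z | _       = ⊥-elim (<-irrefl refl z<z)
... | no z≮z  | yes z<x rewrite rank-∷-≮ w z≮z | rank-∷-< w z<x = s≤s (rank-mono w (<⇒≤ y<x))
... | no _    | no z≮x  = ⊥-elim (z≮x y<x)
rank-strict (z ∷ w) {x} {y} y<x (there y∈w) with z <? y | z <? x
... | yes z<y | yes z<x rewrite rank-∷-< w z<y | rank-∷-< w z<x = s≤s (rank-strict w y<x y∈w)
... | yes z<y | no z≮x  = ⊥-elim (z≮x (<-trans z<y y<x))
... | no z≮y  | yes z<x rewrite rank-∷-≮ w z≮y | rank-∷-< w z<x = m<n⇒m<1+n (rank-strict w y<x y∈w)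
... | no z≮y  | no z≮x  rewrite rank-∷-≮ w z≮y | rank-∷-≮ w z≮x = rank-strict w y<x y∈w

OrderIso : (ℕ → ℕ) → ℕ → ℕ → Set
OrderIso f y x = (y < x → f y < f x) × (f y < f x → y < x)

rank-map : ∀ (f : ℕ → ℕ) x v → (∀ y → y ∈ v → OrderIso f y x) →
           rank (map f v) (f x) ≡ rank v x
rank-map f x [] iso = refl
rank-map f x (y ∷ v) iso with f y <? f x | y <? x
... | yes fy<fx | yes y<x rewrite rank-∷-< (map f v) fy<fx | rank-∷-< v y<x =
  cong suc (rank-map f x v (λ y′ m → iso y′ (there m)))
... | yes fy<fx | no y≮x  = ⊥-elim (y≮x (proj₂ (iso y (here refl)) fy<fx))
... | no fy≮fx  | yes y<x = ⊥-elim (fy≮fx (proj₁ (iso y (here refl)) y<x))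
... | no fy≮fx  | no y≮x rewrite rank-∷-≮ (map f v) fy≮fx | rank-∷-≮ v y≮x =
  rank-map f x v (λ y′ m → iso y′ (there m))

std-map : ∀ (f : ℕ → ℕ) u → (∀ x y → x ∈ u → y ∈ u → OrderIso f y x) →
          std (map f u) ≡ std u
std-map f u iso = begin
    map (λ x → suc (rank (map f u) x)) (map f u)
  ≡⟨ sym (map-∘ u) ⟩
    map (λ x → suc (rank (map f u) (f x))) u
  ≡⟨ map-cong-local (All.tabulate (λ {x} x∈u → cong suc (rank-map f x u (λ y y∈u → iso x y x∈u y∈u)))) ⟩
    map (λ x → suc (rank u x)) u ∎
  where open ≡-Reasoning

rank-orderIso : ∀ w x y → y ∈ w → OrderIso (λ z → suc (rank w z)) y x
rank-orderIso w x y y∈w = (λ y<x → s≤s (rank-strict w y<x y∈w)) , reflect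
  where
  reflect : suc (rank w y) < suc (rank w x) → y < x
  reflect lt with y <? x
  ... | yes y<x = y<x
  ... | no y≮x  = ⊥-elim (<-irrefl refl (<-≤-trans (s<s⁻¹ lt) (rank-mono w (≮⇒≥ y≮x))))

∈-factor : ∀ {x : ℕ} p k xs → x ∈ factor p k xs → x ∈ xs
∈-factor p k xs = Any-resp-⊆ (⊆-trans (take-⊆ k (drop p xs)) (drop-⊆ p xs))

std-factor-std : ∀ p k w → std (factor p k (std w)) ≡ std (factor p k w)
std-factor-std p k w = begin
    std (take k (drop p (map r w)))  ≡⟨ cong (λ v → std (take k v)) (drop-map p w) ⟩
    std (take k (map r (drop p w)))  ≡⟨ cong std (take-map k (drop p w)) ⟩
    std (map r (factor p k w))       ≡⟨ std-map r (factor p k w) (λ x y _ y∈ → rank-orderIso w x y (∈-factor p k w y∈)) ⟩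
    std (factor p k w)               ∎
  where
  open ≡-Reasoning
  r : ℕ → ℕ
  r x = suc (rank w x)

length-std : ∀ w → length (std w) ≡ length w
length-std w = length-map _ w

rank-suc : ∀ xs t → rank (map suc xs) (suc t) ≡ rank xs t
rank-suc [] t = refl
rank-suc (x ∷ xs) t with x <ᵇ t
... | true  = cong suc (rank-suc xs t)
... | false = rank-suc xs t

rank-zero : ∀ xs → rank xs 0 ≡ 0
rank-zero [] = refl
rank-zero (x ∷ xs) = rank-zero xs

rank-upTo : ∀ n t → t ≤ n → rank (upTo n) t ≡ t
rank-upTo n zero _ = rank-zero (upTo n)
rank-upTo (suc n) (suc t) (s≤s t≤n) = cong suc (begin
    rank (applyUpTo suc n) (suc t)  ≡⟨ cong (λ v → rank v (suc t)) (sym (map-upTo suc n)) ⟩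
    rank (map suc (upTo n)) (suc t) ≡⟨ rank-suc (upTo n) t ⟩
    rank (upTo n) t                 ≡⟨ rank-upTo n t t≤n ⟩
    t                               ∎)
  where open ≡-Reasoning

std-perm : ∀ τ → IsPerm τ → std τ ≡ τ
std-perm τ (_ , τ↭) = trans (map-cong-local (All.tabulate (λ {x} → rank-letter x))) (map-id τ)
  where
  rank-letter : ∀ x → x ∈ τ → suc (rank τ x) ≡ x
  rank-letter x x∈τ with ∈-map⁻ suc (↭.∈-resp-↭ τ↭ x∈τ)
  ... | t , t∈ , refl = cong suc (begin
      rank τ (suc t)                            ≡⟨ ↭.↭-length (↭.filter-↭ (_<? suc t) τ↭) ⟩
      rank (map suc (upTo (length τ))) (suc t)  ≡⟨ rank-suc (upTo (length τ)) t ⟩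
      rank (upTo (length τ)) t                  ≡⟨ rank-upTo (length τ) t (<⇒≤ (∈-upTo⁻ t∈)) ⟩
      t                                         ∎)
    where open ≡-Reasoning

factor-factor : ∀ p k s K (xs : List ℕ) → p + k ≤ K →
                factor p k (factor s K xs) ≡ factor (s + p) k xs
factor-factor p k s K xs p+k≤K = begin
    take k (drop p (take K ys))           ≡⟨ take-drop k p (take K ys) ⟩
    drop p (take (p + k) (take K ys))     ≡⟨ cong (drop p) (take-take (p + k) K ys) ⟩
    drop p (take ((p + k) ⊓ K) ys)        ≡⟨ cong (λ n → drop p (take n ys)) (m≤n⇒m⊓n≡m p+k≤K) ⟩
    drop p (take (p + k) ys)              ≡⟨ take-drop k p ys ⟨
    take k (drop p ys)                    ≡⟨ cong (take k) (drop-drop s p xs) ⟩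
    take k (drop (s + p) xs)              ∎
  where
  open ≡-Reasoning
  ys = drop s xs

length-factor : ∀ s k (xs : List ℕ) → s + k ≤ length xs → length (factor s k xs) ≡ k
length-factor s k xs s+k≤ = begin
    length (take k (drop s xs))    ≡⟨ length-take k (drop s xs) ⟩
    k ⊓ length (drop s xs)         ≡⟨ cong (k ⊓_) (length-drop s xs) ⟩
    k ⊓ (length xs ∸ s)            ≡⟨ m≤n⇒m⊓n≡m k≤ ⟩
    k                              ∎
  where
  open ≡-Reasoning
  k≤ : k ≤ length xs ∸ s
  k≤ = subst (_≤ length xs ∸ s) (m+n∸m≡n s k) (∸-monoˡ-≤ s s+k≤)

module Windows (τ : List ℕ) where

  window : ℕ → ℕ → List ℕ
  window s K = std (factor s K τ)

  length-window : ∀ s K → s + K ≤ length τ → length (window s K) ≡ K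
  length-window s K s+K≤ = trans (length-std (factor s K τ)) (length-factor s K τ s+K≤)

  window-factor : ∀ s K p k → p + k ≤ K → std (factor p k (window s K)) ≡ window (s + p) k
  window-factor s K p k p+k≤K =
    trans (std-factor-std p k (factor s K τ)) (cong std (factor-factor p k s K τ p+k≤K))

  occ-window⁻ : ∀ σ s K q → s + K ≤ length τ → OccAt σ (window s K) q →
                q + length σ ≤ K × OccAt σ τ (s + q)
  occ-window⁻ σ s K q s+K≤ (fits , isσ) = fits′ , inside , trans (sym (window-factor s K q (length σ) fits′)) isσ
    where
    fits′ : q + length σ ≤ K
    fits′ = subst (q + length σ ≤_) (length-window s K s+K≤) fits
    inside : s + q + length σ ≤ length τ
    inside = subst (_≤ length τ) (sym (+-assoc s q (length σ))) (≤-trans (+-monoʳ-≤ s fits′) s+K≤)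

  occ-window⁺ : ∀ σ s K q → s + K ≤ length τ → q + length σ ≤ K → OccAt σ τ (s + q) →
                OccAt σ (window s K) q
  occ-window⁺ σ s K q s+K≤ fits′ (_ , isσ) = fits , trans (window-factor s K q (length σ) fits′) isσ
    where
    fits : q + length σ ≤ length (window s K)
    fits = subst (q + length σ ≤_) (sym (length-window s K s+K≤)) fits′

properPatterns⁻ : ∀ {y} z → y ∈ properPatterns z →
  ∃ λ p → ∃ λ k → p + k ≤ length z × y ≡ std (factor p k z) × length y < length z
properPatterns⁻ {y} z y∈ with ∈-filter⁻ (λ w → length w <? length z) (∈-deduplicate⁻ (≡-dec _≟_) _ y∈)
... | y∈′ , shorter with find (∈-concatMap⁻ _ {xs = upTo (length z)} y∈′)
... | p , p∈ , y∈″ with ∈-map⁻ _ y∈″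
... | k , k∈ , refl = p , suc k , fits , refl , shorter
  where
  fits : p + suc k ≤ length z
  fits = subst (p + suc k ≤_) (m+[n∸m]≡n (<⇒≤ (∈-upTo⁻ p∈))) (+-monoʳ-≤ p (∈-upTo⁻ k∈))

properPatterns⁺ : ∀ z p k → 1 ≤ k → p + k ≤ length z → k < length z →
                  std (factor p k z) ∈ properPatterns z
properPatterns⁺ z p (suc k) _ fits shorter = ∈-deduplicate⁺ (≡-dec _≟_)
    (∈-filter⁺ (λ w → length w <? length z)
      (∈-concatMap⁺ _ {xs = upTo (length z)} (lose (∈-upTo⁺ p<) (∈-map⁺ _ (∈-upTo⁺ k<))))
      (subst (_< length z) (sym length-y) shorter))
  where
  p< : p < length z
  p< = <-≤-trans (m<m+n p {suc k} (s≤s z≤n)) fits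
  k< : k < length z ∸ p
  k< = subst (_≤ length z ∸ p) (m+n∸m≡n p (suc k)) (∸-monoˡ-≤ p fits)
  length-y : length (std (factor p (suc k) z)) ≡ suc k
  length-y = trans (length-std (factor p (suc k) z)) (length-factor p (suc k) z fits)

properPatterns-unique : ∀ z → Unique (properPatterns z)
properPatterns-unique z = deduplicate-! (≡-dec _≟_) _

properPatterns-shorter : ∀ {y} z → y ∈ properPatterns z → length y < length z
properPatterns-shorter z y∈ with properPatterns⁻ z y∈
... | _ , _ , _ , _ , shorter = shorter

below : List ℕ → List ℕ → List (List ℕ)
below σ z = filter (contains? σ) (properPatterns z)

top∉below : ∀ σ z → z ∈ below σ z → ⊥
top∉below σ z z∈ = <-irrefl refl (properPatterns-shorter z (proj₁ (∈-filter⁻ (contains? σ) z∈)))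

occurrence⇒found : ∀ {σ z q} → OccAt σ z q → Any (OccAt σ z) (upTo (suc (length z)))
occurrence⇒found {σ} {z} {q} occ@(fits , _) =
  lose (∈-upTo⁺ (s≤s (≤-trans (m≤m+n q (length σ)) fits))) occ

μ′-refl : ∀ n σ → μ′ n σ σ ≡ + 1
μ′-refl n σ with ≡-dec _≟_ σ σ
... | yes _ = refl
... | no σ≢σ = ⊥-elim (σ≢σ refl)

μ′-step : ∀ m σ z q → σ ≢ z → OccAt σ z q → μ′ (suc m) σ z ≡ - sumℤ (map (μ′ m σ) (below σ z))
μ′-step m σ z q σ≢z occ with ≡-dec _≟_ σ z
... | yes σ≡z = ⊥-elim (σ≢z σ≡z)
... | no _ rewrite dec-true (contains? σ z) (occurrence⇒found occ) = refl

sumℤ-↭ : ∀ {xs ys : List ℤ} → xs ↭ ys → sumℤ xs ≡ sumℤ ys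
sumℤ-↭ xs↭ys = foldr-commMonoid ℤ+.setoid ℤ+.isCommutativeMonoid (↭⇒↭ₛ xs↭ys)
  where module ℤ+ = CommutativeMonoid ℤ.+-0-commutativeMonoid

sumℤ-++ : ∀ (xs ys : List ℤ) → sumℤ (xs ++ ys) ≡ sumℤ xs +ℤ sumℤ ys
sumℤ-++ [] ys = sym (ℤ.+-identityˡ _)
sumℤ-++ (x ∷ xs) ys = trans (cong (x +ℤ_) (sumℤ-++ xs ys)) (sym (ℤ.+-assoc x _ _))

sumℤ-scale : ∀ {A : Set} c (f : A → ℤ) xs → sumℤ (map (λ x → c *ℤ f x) xs) ≡ c *ℤ sumℤ (map f xs)
sumℤ-scale c f [] = sym (ℤ.*-zeroʳ c)
sumℤ-scale c f (x ∷ xs) = trans (cong (c *ℤ f x +ℤ_) (sumℤ-scale c f xs)) (sym (ℤ.*-distribˡ-+ c _ _))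

sumℤ-cartesianProduct : ∀ {A B : Set} (f : A → ℤ) (h : B → ℤ) xs ys →
  sumℤ (map (λ p → f (proj₁ p) *ℤ h (proj₂ p)) (cartesianProduct xs ys))
    ≡ sumℤ (map f xs) *ℤ sumℤ (map h ys)
sumℤ-cartesianProduct f h [] ys = refl
sumℤ-cartesianProduct f h (x ∷ xs) ys = begin
    sumℤ (map F (map (x ,_) ys ++ cartesianProduct xs ys))
  ≡⟨ cong sumℤ (map-++ F (map (x ,_) ys) _) ⟩
    sumℤ (map F (map (x ,_) ys) ++ map F (cartesianProduct xs ys))
  ≡⟨ sumℤ-++ (map F (map (x ,_) ys)) _ ⟩
    sumℤ (map F (map (x ,_) ys)) +ℤ sumℤ (map F (cartesianProduct xs ys))
  ≡⟨ cong₂ _+ℤ_ (trans (cong sumℤ (sym (map-∘ ys))) (sumℤ-scale (f x) h ys))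
                (sumℤ-cartesianProduct f h xs ys) ⟩
    f x *ℤ sumℤ (map h ys) +ℤ sumℤ (map f xs) *ℤ sumℤ (map h ys)
  ≡⟨ ℤ.*-distribʳ-+ (sumℤ (map h ys)) (f x) _ ⟨
    (f x +ℤ sumℤ (map f xs)) *ℤ sumℤ (map h ys)
  ∎
  where
  open ≡-Reasoning
  F = λ p → f (proj₁ p) *ℤ h (proj₂ p)

-- The Möbius function μ(0, x) of the chain 0 < 1 < 2 < ⋯
chainμ : ℕ → ℤ
chainμ 0 = + 1
chainμ 1 = -[1+ 0 ]
chainμ (suc (suc _)) = + 0

δ : ℕ → ℤ
δ 0 = + 1
δ (suc _) = + 0

chainμ-sum : ∀ i → sumℤ (map chainμ (upTo (suc i))) ≡ δ i
chainμ-sum zero = refl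
chainμ-sum (suc i) = begin
    sumℤ (map chainμ (upTo (suc (suc i))))
  ≡⟨ cong (λ v → sumℤ (map chainμ v)) (sym (upTo-∷ʳ (suc i))) ⟩
    sumℤ (map chainμ (upTo (suc i) ∷ʳ suc i))
  ≡⟨ cong sumℤ (map-++ chainμ (upTo (suc i)) (suc i ∷ [])) ⟩
    sumℤ (map chainμ (upTo (suc i)) ++ chainμ (suc i) ∷ [])
  ≡⟨ sumℤ-++ (map chainμ (upTo (suc i))) (chainμ (suc i) ∷ []) ⟩
    sumℤ (map chainμ (upTo (suc i))) +ℤ (chainμ (suc i) +ℤ + 0)
  ≡⟨ cong₂ _+ℤ_ (chainμ-sum i) (ℤ.+-identityʳ _) ⟩
    δ i +ℤ chainμ (suc i)
  ≡⟨ last i ⟩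
    + 0
  ∎
  where
  open ≡-Reasoning
  last : ∀ i → δ i +ℤ chainμ (suc i) ≡ + 0
  last zero = refl
  last (suc i) = refl

grid : ℕ → ℕ → List (ℕ × ℕ)
grid i j = cartesianProduct (upTo (suc i)) (upTo (suc j))

∈-grid⁺ : ∀ {i j x y} → x ≤ i → y ≤ j → (x , y) ∈ grid i j
∈-grid⁺ x≤i y≤j = ∈-cartesianProduct⁺ (∈-upTo⁺ (s≤s x≤i)) (∈-upTo⁺ (s≤s y≤j))

∈-grid⁻ : ∀ i j {x y} → (x , y) ∈ grid i j → x ≤ i × y ≤ j
∈-grid⁻ i j xy∈ with ∈-cartesianProduct⁻ (upTo (suc i)) (upTo (suc j)) xy∈
... | x∈ , y∈ = s≤s⁻¹ (∈-upTo⁻ x∈) , s≤s⁻¹ (∈-upTo⁻ y∈)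

grid-unique : ∀ i j → Unique (grid i j)
grid-unique i j = Unique.cartesianProduct⁺ (Unique.upTo⁺ (suc i)) (Unique.upTo⁺ (suc j))

-- The Möbius function of the product of two chains.
gridμ : ℕ × ℕ → ℤ
gridμ (x , y) = chainμ x *ℤ chainμ y

gridμ-sum : ∀ i j → sumℤ (map gridμ (grid i j)) ≡ δ i *ℤ δ j
gridμ-sum i j = trans (sumℤ-cartesianProduct chainμ chainμ (upTo (suc i)) (upTo (suc j)))
                      (cong₂ _*ℤ_ (chainμ-sum i) (chainμ-sum j))

δ-product-zero : ∀ {i j} → ¬ (i ≡ 0 × j ≡ 0) → δ i *ℤ δ j ≡ + 0
δ-product-zero {zero} {zero} not-bottom = ⊥-elim (not-bottom (refl , refl))
δ-product-zero {zero} {suc j} _ = refl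
δ-product-zero {suc i} _ = refl

Theorem2p1Cases : ℕ → ℕ → ℤ → Set
Theorem2p1Cases x y v =
  ((((x ≡ 0) × (y ≡ 0)) ⊎ ((x ≡ 1) × (y ≡ 1))) → v ≡ + 1)
  × ((((x ≡ 0) × (y ≡ 1)) ⊎ ((x ≡ 1) × (y ≡ 0))) → v ≡ -[1+ 0 ])
  × (¬ (((x ≡ 0) × (y ≡ 0)) ⊎ ((x ≡ 1) × (y ≡ 1))
        ⊎ ((x ≡ 0) × (y ≡ 1)) ⊎ ((x ≡ 1) × (y ≡ 0))) → v ≡ + 0)

gridμ-cases : ∀ x y → Theorem2p1Cases x y (gridμ (x , y))
gridμ-cases 0 0 = (λ _ → refl) , (λ { (inj₁ (_ , ())) ; (inj₂ (() , _)) }) , (λ ≢ → ⊥-elim (≢ (inj₁ (refl , refl))))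
gridμ-cases 1 1 = (λ _ → refl) , (λ { (inj₁ (() , _)) ; (inj₂ (_ , ())) }) , (λ ≢ → ⊥-elim (≢ (inj₂ (inj₁ (refl , refl)))))
gridμ-cases 0 1 = (λ { (inj₁ (_ , ())) ; (inj₂ (() , _)) }) , (λ _ → refl) , (λ ≢ → ⊥-elim (≢ (inj₂ (inj₂ (inj₁ (refl , refl))))))
gridμ-cases 1 0 = (λ { (inj₁ (() , _)) ; (inj₂ (_ , ())) }) , (λ _ → refl) , (λ ≢ → ⊥-elim (≢ (inj₂ (inj₂ (inj₂ (refl , refl))))))
gridμ-cases 0 (suc (suc y)) = (λ { (inj₁ (_ , ())) ; (inj₂ (() , _)) }) , (λ { (inj₁ (_ , ())) ; (inj₂ (() , _)) }) , (λ _ → refl)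
gridμ-cases 1 (suc (suc y)) = (λ { (inj₁ (() , _)) ; (inj₂ (_ , ())) }) , (λ { (inj₁ (() , _)) ; (inj₂ (_ , ())) }) , (λ _ → refl)
gridμ-cases (suc (suc x)) y = (λ { (inj₁ (() , _)) ; (inj₂ (() , _)) }) , (λ { (inj₁ (() , _)) ; (inj₂ (() , _)) }) , (λ _ → refl)

Unique-map⁺ : ∀ {A B : Set} (f : A → B) {xs : List A} → Unique xs →
              (∀ {x y} → x ∈ xs → y ∈ xs → f x ≡ f y → x ≡ y) → Unique (map f xs)
Unique-map⁺ f {[]} [] _ = []
Unique-map⁺ f {x ∷ xs} (x∉ ∷ uniq) inj =
  All.tabulate fresh ∷ Unique-map⁺ f uniq (λ x∈ y∈ → inj (there x∈) (there y∈))
  where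
  fresh : ∀ {v} → v ∈ map f xs → f x ≢ v
  fresh v∈ fx≡v with ∈-map⁻ f v∈
  ... | y , y∈ , refl = All.lookup x∉ y∈ (inj (here refl) (there y∈) fx≡v)

-- Coordinates of nested windows: if i′ ≤ i ≤ a, the window starting i′
-- letters before a starts i ∸ i′ letters after the one starting i before a.
∸-telescope : ∀ {a i i′} → i′ ≤ i → i ≤ a → a ∸ i + (i ∸ i′) ≡ a ∸ i′
∸-telescope {a} {i} {i′} i′≤i i≤a = +-cancelʳ-≡ i′ _ _ (begin
    a ∸ i + (i ∸ i′) + i′    ≡⟨ +-assoc (a ∸ i) (i ∸ i′) i′ ⟩
    a ∸ i + (i ∸ i′ + i′)    ≡⟨ cong (λ t → a ∸ i + t) (m∸n+n≡m i′≤i) ⟩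
    a ∸ i + i                ≡⟨ m∸n+n≡m i≤a ⟩
    a                        ≡⟨ m∸n+n≡m (≤-trans i′≤i i≤a) ⟨
    a ∸ i′ + i′              ∎)
  where open ≡-Reasoning

-- Coordinates of a window inside the window of ext i j: if the inner window
-- starts p letters into the outer one, has length k, and its occurrence of σ
-- (of length l) starts q letters in and coincides with the one at a, then
-- it extends q ≤ i letters left and k ∸ (q + l) ≤ j letters right of it.
coordinates : ∀ {a i j l p q k} → i ≤ a → a ∸ i + p + q ≡ a → p + k ≤ l + i + j →
              q ≤ i × k ∸ (q + l) ≤ j
coordinates {a} {i} {j} {l} {p} {q} {k} i≤a start≡ p+k≤ = q≤i , m≤n+o⇒m∸n≤o k (q + l) k≤
  where
  p+q≡i : p + q ≡ i
  p+q≡i = +-cancelˡ-≡ (a ∸ i) (p + q) i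
            (trans (sym (+-assoc (a ∸ i) p q)) (trans start≡ (sym (m∸n+n≡m i≤a))))
  q≤i : q ≤ i
  q≤i = subst (q ≤_) p+q≡i (m≤n+m q p)
  rearrange : l + i + j ≡ p + (q + l + j)
  rearrange = trans (cong (λ t → l + t + j) (sym p+q≡i))
                    (solve 4 (λ l p q j → l :+ (p :+ q) :+ j := p :+ (q :+ l :+ j)) refl l p q j)
  k≤ : k ≤ q + l + j
  k≤ = +-cancelˡ-≤ p k (q + l + j) (subst (p + k ≤_) rearrange p+k≤)

grid-lower : ∀ {l i j i′ j′} → i′ ≤ i → j′ ≤ j → ¬ (i′ ≡ i × j′ ≡ j) → l + i′ + j′ < l + i + j
grid-lower {l} {i} {j} {i′} i′≤i j′≤j ≢ with i′ ≟ i
... | yes refl = +-monoʳ-< (l + i′) (≤∧≢⇒< j′≤j (λ j′≡j → ≢ (refl , j′≡j)))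
... | no i′≢i  = +-mono-<-≤ (+-monoʳ-< l (≤∧≢⇒< i′≤i i′≢i)) j′≤j

module Interval (σ τ : List ℕ) (a b : ℕ) (σ-nonempty : 1 ≤ length σ)
                (occ : OccAt σ τ a) (once : ∀ q → OccAt σ τ q → q ≡ a)
                (fills : a + length σ + b ≡ length τ) where

  open Windows τ

  l : ℕ
  l = length σ

  ext : ℕ → ℕ → List ℕ
  ext i j = window (a ∸ i) (l + i + j)

  ext-fits : ∀ {i j} → i ≤ a → j ≤ b → a ∸ i + (l + i + j) ≤ length τ
  ext-fits {i} {j} i≤a j≤b = begin
      a ∸ i + (l + i + j)  ≡⟨ solve 4 (λ s l i j → s :+ (l :+ i :+ j) := s :+ i :+ l :+ j) refl (a ∸ i) l i j ⟩
      a ∸ i + i + l + j    ≡⟨ cong (λ t → t + l + j) (m∸n+n≡m i≤a) ⟩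
      a + l + j            ≤⟨ +-monoʳ-≤ (a + l) j≤b ⟩
      a + l + b            ≡⟨ fills ⟩
      length τ             ∎
    where open ≤-Reasoning

  length-ext : ∀ {i j} → i ≤ a → j ≤ b → length (ext i j) ≡ l + i + j
  length-ext {i} {j} i≤a j≤b = length-window (a ∸ i) (l + i + j) (ext-fits i≤a j≤b)

  occ-ext : ∀ {i j} → i ≤ a → j ≤ b → OccAt σ (ext i j) i
  occ-ext {i} {j} i≤a j≤b = occ-window⁺ σ (a ∸ i) (l + i + j) i (ext-fits i≤a j≤b)
    (subst (_≤ l + i + j) (+-comm l i) (m≤m+n (l + i) j))
    (subst (OccAt σ τ) (sym (m∸n+n≡m i≤a)) occ)

  occ-ext-unique : ∀ {i j q} → i ≤ a → j ≤ b → OccAt σ (ext i j) q → q ≡ i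
  occ-ext-unique {i} {j} {q} i≤a j≤b occ′ =
    +-cancelˡ-≡ (a ∸ i) q i (trans (once _ (proj₂ (occ-window⁻ σ (a ∸ i) _ q (ext-fits i≤a j≤b) occ′)))
                                   (sym (m∸n+n≡m i≤a)))

  -- ext is injective on the grid: the position of σ recovers i, the length j.
  ext-injective : ∀ {i j i′ j′} → i ≤ a → j ≤ b → i′ ≤ a → j′ ≤ b →
                  ext i j ≡ ext i′ j′ → i ≡ i′ × j ≡ j′
  ext-injective {i} {j} {i′} {j′} i≤a j≤b i′≤a j′≤b eq = i≡i′ , j≡j′
    where
    i≡i′ : i ≡ i′
    i≡i′ = occ-ext-unique i′≤a j′≤b (subst (λ z → OccAt σ z i) eq (occ-ext i≤a j≤b))
    j≡j′ : j ≡ j′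
    j≡j′ = +-cancelˡ-≡ (l + i) j j′ (begin
      l + i + j           ≡⟨ length-ext i≤a j≤b ⟨
      length (ext i j)    ≡⟨ cong length eq ⟩
      length (ext i′ j′)  ≡⟨ length-ext i′≤a j′≤b ⟩
      l + i′ + j′         ≡⟨ cong (λ t → l + t + j′) i≡i′ ⟨
      l + i + j′          ∎)
      where open ≡-Reasoning

  ext-bottom : ext 0 0 ≡ σ
  ext-bottom = trans (cong (λ k → std (factor a k τ)) (trans (+-identityʳ _) (+-identityʳ _))) (proj₂ occ)

  ext-top : IsPerm τ → ext a b ≡ τ
  ext-top τ-perm = begin
      std (factor (a ∸ a) (l + a + b) τ)  ≡⟨ cong₂ (λ s k → std (factor s k τ)) (n∸n≡0 a) length≡ ⟩
      std (take (length τ) τ)             ≡⟨ cong std (take-all (length τ) τ ≤-refl) ⟩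
      std τ                               ≡⟨ std-perm τ τ-perm ⟩
      τ                                   ∎
    where
    open ≡-Reasoning
    length≡ : l + a + b ≡ length τ
    length≡ = trans (cong (_+ b) (+-comm l a)) fills

  ext-shorter : ∀ {i j i′ j′} → i ≤ a → j ≤ b → i′ ≤ i → j′ ≤ j → ¬ (i′ ≡ i × j′ ≡ j) →
                length (ext i′ j′) < length (ext i j)
  ext-shorter i≤a j≤b i′≤i j′≤j ≢ rewrite length-ext (≤-trans i′≤i i≤a) (≤-trans j′≤j j≤b) | length-ext i≤a j≤b =
    grid-lower i′≤i j′≤j ≢

  window-as-ext : ∀ s k q → s + k ≤ length τ → OccAt σ (window s k) q →
                  s + q ≡ a × window s k ≡ ext q (k ∸ (q + l))
  window-as-ext s k q fits occ′ with occ-window⁻ σ s k q fits occ′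
  ... | q+l≤k , occ-τ = s+q≡a , cong₂ window start size
    where
    s+q≡a : s + q ≡ a
    s+q≡a = once (s + q) occ-τ
    start : s ≡ a ∸ q
    start = trans (sym (m+n∸n≡m s q)) (cong (_∸ q) s+q≡a)
    size : k ≡ l + q + (k ∸ (q + l))
    size = trans (sym (m+[n∸m]≡n q+l≤k)) (cong (_+ (k ∸ (q + l))) (+-comm q l))

  factor-of-ext : ∀ {i j} p k → i ≤ a → j ≤ b → p + k ≤ l + i + j →
                  a ∸ i + p + k ≤ length τ × std (factor p k (ext i j)) ≡ window (a ∸ i + p) k
  factor-of-ext {i} {j} p k i≤a j≤b p+k≤K =
    subst (_≤ length τ) (sym (+-assoc (a ∸ i) p k)) (≤-trans (+-monoʳ-≤ (a ∸ i) p+k≤K) (ext-fits i≤a j≤b)) ,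
    window-factor (a ∸ i) (l + i + j) p k p+k≤K

  below⁻ : ∀ {i j y} → i ≤ a → j ≤ b → y ∈ below σ (ext i j) →
           ∃ λ i′ → ∃ λ j′ → i′ ≤ i × j′ ≤ j × y ≡ ext i′ j′
  below⁻ {i} {j} i≤a j≤b y∈ with ∈-filter⁻ (contains? σ) y∈
  ... | y∈pp , found with properPatterns⁻ (ext i j) y∈pp | satisfied found
  ... | p , k , p+k≤ , refl , _ | q , occ-y
      with p+k≤K ← subst (p + k ≤_) (length-ext i≤a j≤b) p+k≤
      with factor-of-ext p k i≤a j≤b p+k≤K
  ... | inside , is-window with window-as-ext (a ∸ i + p) k q inside (subst (λ w → OccAt σ w q) is-window occ-y)
  ... | start≡ , y≡ext with coordinates i≤a start≡ p+k≤K
  ... | q≤i , j′≤j = q , k ∸ (q + l) , q≤i , j′≤j , trans is-window y≡ext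

  below⁺ : ∀ {i j i′ j′} → i ≤ a → j ≤ b → i′ ≤ i → j′ ≤ j → ¬ (i′ ≡ i × j′ ≡ j) →
           ext i′ j′ ∈ below σ (ext i j)
  below⁺ {i} {j} {i′} {j′} i≤a j≤b i′≤i j′≤j ≢ =
    ∈-filter⁺ (contains? σ)
      (subst (_∈ properPatterns (ext i j)) is-ext
        (properPatterns⁺ (ext i j) (i ∸ i′) (l + i′ + j′) nonempty
          (subst (i ∸ i′ + (l + i′ + j′) ≤_) (sym (length-ext i≤a j≤b)) p+k≤K)
          (subst (_< length (ext i j)) (length-ext i′≤a j′≤b) (ext-shorter i≤a j≤b i′≤i j′≤j ≢))))
      (occurrence⇒found (occ-ext i′≤a j′≤b))
    where
    i′≤a = ≤-trans i′≤i i≤a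
    j′≤b = ≤-trans j′≤j j≤b
    nonempty : 1 ≤ l + i′ + j′
    nonempty = ≤-trans σ-nonempty (≤-trans (m≤m+n l i′) (m≤m+n (l + i′) j′))
    p+k≤K : i ∸ i′ + (l + i′ + j′) ≤ l + i + j
    p+k≤K = begin
      i ∸ i′ + (l + i′ + j′)   ≡⟨ solve 4 (λ p l i′ j′ → p :+ (l :+ i′ :+ j′) := l :+ (p :+ i′) :+ j′) refl (i ∸ i′) l i′ j′ ⟩
      l + (i ∸ i′ + i′) + j′   ≡⟨ cong (λ t → l + t + j′) (m∸n+n≡m i′≤i) ⟩
      l + i + j′               ≤⟨ +-monoʳ-≤ (l + i) j′≤j ⟩
      l + i + j                ∎
      where open ≤-Reasoning
    is-ext : std (factor (i ∸ i′) (l + i′ + j′) (ext i j)) ≡ ext i′ j′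
    is-ext = trans (proj₂ (factor-of-ext (i ∸ i′) (l + i′ + j′) i≤a j≤b p+k≤K))
                   (cong (λ s → window s (l + i′ + j′)) (∸-telescope i′≤i i≤a))

  ext₂ : ℕ × ℕ → List ℕ
  ext₂ (x , y) = ext x y

  -- [σ, ext i j] ≅ [0,i] × [0,j]: listing the interval by its top followed by
  -- the patterns strictly below it is a rearrangement of the ext's over the grid.
  interval-enumeration : ∀ {i j} → i ≤ a → j ≤ b →
                         (ext i j ∷ below σ (ext i j)) ↭ map ext₂ (grid i j)
  interval-enumeration {i} {j} i≤a j≤b = ∼bag⇒↭ (unique∧set⇒bag unique-interval unique-grid (mk⇔ to from))
    where
    in-range : ∀ {x y} → (x , y) ∈ grid i j → x ≤ a × y ≤ b
    in-range xy∈ = ≤-trans (proj₁ (∈-grid⁻ i j xy∈)) i≤a , ≤-trans (proj₂ (∈-grid⁻ i j xy∈)) j≤b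
    unique-interval : Unique (ext i j ∷ below σ (ext i j))
    unique-interval = All.tabulate (λ y∈ top≡y → top∉below σ (ext i j) (subst (_∈ below σ (ext i j)) (sym top≡y) y∈))
                    ∷ Unique.filter⁺ (contains? σ) (properPatterns-unique (ext i j))
    unique-grid : Unique (map ext₂ (grid i j))
    unique-grid = Unique-map⁺ ext₂ (grid-unique i j) injective
      where
      injective : ∀ {p p′} → p ∈ grid i j → p′ ∈ grid i j → ext₂ p ≡ ext₂ p′ → p ≡ p′
      injective {_ , _} {_ , _} p∈ p′∈ eq with in-range p∈ | in-range p′∈
      ... | x≤a , y≤b | x′≤a , y′≤b = uncurry (cong₂ _,_) (ext-injective x≤a y≤b x′≤a y′≤b eq)
    to : ∀ {y} → y ∈ ext i j ∷ below σ (ext i j) → y ∈ map ext₂ (grid i j)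
    to (here refl) = ∈-map⁺ ext₂ (∈-grid⁺ ≤-refl ≤-refl)
    to (there y∈) with below⁻ i≤a j≤b y∈
    ... | i′ , j′ , i′≤i , j′≤j , refl = ∈-map⁺ ext₂ (∈-grid⁺ i′≤i j′≤j)
    from : ∀ {y} → y ∈ map ext₂ (grid i j) → y ∈ ext i j ∷ below σ (ext i j)
    from y∈ with ∈-map⁻ ext₂ y∈
    ... | (i′ , j′) , ij∈ , refl with ∈-grid⁻ i j ij∈ | (i′ ≟ i) ×-dec (j′ ≟ j)
    ... | _ , _         | yes (refl , refl) = here refl
    ... | i′≤i , j′≤j   | no ≢             = there (below⁺ i≤a j≤b i′≤i j′≤j ≢)

  -- The sum over [σ, ext i j] of (μ′ m σ, patched to gridμ(i,j) at the top)
  -- is the sum of gridμ over the grid, δ i · δ j = 0.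
  μ-ext-step : ∀ m {i j} → i ≤ a → j ≤ b → ¬ (i ≡ 0 × j ≡ 0) →
    (∀ {i′ j′} → i′ ≤ i → j′ ≤ j → ¬ (i′ ≡ i × j′ ≡ j) → μ′ m σ (ext i′ j′) ≡ gridμ (i′ , j′)) →
    μ′ (suc m) σ (ext i j) ≡ gridμ (i , j)
  μ-ext-step m {i} {j} i≤a j≤b not-bottom below-ok = begin
      μ′ (suc m) σ z                       ≡⟨ μ′-step m σ z i σ≢z (occ-ext i≤a j≤b) ⟩
      - sumℤ (map (μ′ m σ) (below σ z))    ≡⟨ cong -_ (inverseʳ-unique (gridμ (i , j)) _ total) ⟩
      - - gridμ (i , j)                    ≡⟨ ℤ.neg-involutive _ ⟩
      gridμ (i , j)                        ∎
    where
    open ≡-Reasoning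
    z = ext i j
    σ≢z : σ ≢ z
    σ≢z σ≡z with ext-injective z≤n z≤n i≤a j≤b (trans ext-bottom σ≡z)
    ... | 0≡i , 0≡j = not-bottom (sym 0≡i , sym 0≡j)
    patched : List ℕ → ℤ
    patched y = if does (≡-dec _≟_ y z) then gridμ (i , j) else μ′ m σ y
    patched-top : patched z ≡ gridμ (i , j)
    patched-top rewrite dec-true (≡-dec _≟_ z z) refl = refl
    patched-other : ∀ y → y ≢ z → patched y ≡ μ′ m σ y
    patched-other y y≢z rewrite dec-false (≡-dec _≟_ y z) y≢z = refl
    patched-grid : ∀ p → p ∈ grid i j → patched (ext₂ p) ≡ gridμ p
    patched-grid (i′ , j′) p∈ with ∈-grid⁻ i j p∈ | (i′ ≟ i) ×-dec (j′ ≟ j)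
    ... | _ , _       | yes (refl , refl) = patched-top
    ... | i′≤i , j′≤j | no ≢ = trans (patched-other _ (≢ ∘ ext-injective (≤-trans i′≤i i≤a) (≤-trans j′≤j j≤b) i≤a j≤b))
                                     (below-ok i′≤i j′≤j ≢)
    total : gridμ (i , j) +ℤ sumℤ (map (μ′ m σ) (below σ z)) ≡ + 0
    total = begin
        gridμ (i , j) +ℤ sumℤ (map (μ′ m σ) (below σ z))
      ≡⟨ cong₂ _+ℤ_ patched-top (cong sumℤ (map-cong-local (All.tabulate (λ {y} y∈ → patched-other y (λ { refl → top∉below σ z y∈ }))))) ⟨
        sumℤ (map patched (z ∷ below σ z))
      ≡⟨ sumℤ-↭ (↭.map⁺ patched (interval-enumeration i≤a j≤b)) ⟩
        sumℤ (map patched (map ext₂ (grid i j)))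
      ≡⟨ cong sumℤ (trans (sym (map-∘ {g = patched} {f = ext₂} (grid i j))) (map-cong-local (All.tabulate (λ {p} → patched-grid p)))) ⟩
        sumℤ (map gridμ (grid i j))
      ≡⟨ gridμ-sum i j ⟩
        δ i *ℤ δ j
      ≡⟨ δ-product-zero not-bottom ⟩
        + 0
      ∎

  μ-ext : ∀ n {i j} → i ≤ a → j ≤ b → length (ext i j) ≤ n → μ′ n σ (ext i j) ≡ gridμ (i , j)
  μ-ext n {i} {j} i≤a j≤b fuel with (i ≟ 0) ×-dec (j ≟ 0)
  μ-ext n i≤a j≤b fuel | yes (refl , refl) = trans (cong (μ′ n σ) ext-bottom) (μ′-refl n σ)
  μ-ext zero {i} {j} i≤a j≤b fuel | no _ =
    ⊥-elim (1+n≰n (≤-trans σ-nonempty (≤-trans (m≤m+n l i) (≤-trans (m≤m+n (l + i) j)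
      (subst (_≤ 0) (length-ext i≤a j≤b) fuel)))))
  μ-ext (suc m) i≤a j≤b fuel | no not-bottom = μ-ext-step m i≤a j≤b not-bottom λ i′≤i j′≤j ≢ →
    μ-ext m (≤-trans i′≤i i≤a) (≤-trans j′≤j j≤b) (s≤s⁻¹ (≤-trans (ext-shorter i≤a j≤b i′≤i j′≤j ≢) fuel))

theorem2p1 : (σ τ : List ℕ) (a b : ℕ) →
  IsPerm σ → IsPerm τ → OccursOnce σ τ →
  LeftTail σ τ a → RightTail σ τ b →
  ((((a ≡ 0) × (b ≡ 0)) ⊎ ((a ≡ 1) × (b ≡ 1))) → μ σ τ ≡ + 1)
  × ((((a ≡ 0) × (b ≡ 1)) ⊎ ((a ≡ 1) × (b ≡ 0))) → μ σ τ ≡ -[1+ 0 ])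
  × (¬ (((a ≡ 0) × (b ≡ 0)) ⊎ ((a ≡ 1) × (b ≡ 1))
        ⊎ ((a ≡ 0) × (b ≡ 1)) ⊎ ((a ≡ 1) × (b ≡ 0))) → μ σ τ ≡ + 0)
theorem2p1 σ τ a b (σ-nonempty , _) τ-perm (_ , _ , only-p) (occ-a , _) ((r , occ-r , r-end , b≤τ) , _) =
  subst (Theorem2p1Cases a b) (sym μ≡gridμ) (gridμ-cases a b)
  where
  once : ∀ q → OccAt σ τ q → q ≡ a
  once q occ-q = trans (only-p q occ-q) (sym (only-p a occ-a))
  fills : a + length σ + b ≡ length τ
  fills = trans (cong (λ t → t + length σ + b) (sym (once r occ-r)))
                (trans (cong (_+ b) r-end) (m∸n+n≡m b≤τ))
  open Interval σ τ a b σ-nonempty occ-a once fills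
  μ≡gridμ : μ σ τ ≡ gridμ (a , b)
  μ≡gridμ = subst (λ z → μ′ (length z) σ z ≡ gridμ (a , b)) (ext-top τ-perm) (μ-ext _ ≤-refl ≤-refl ≤-refl)
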